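{- Let $r\ge 0$ be an integer. (i) If $r\equiv 0\pmod 3$ or $r\equiv 2\pmod 3$, then $\ell_7(3^r)\le 2$. (ii) If $r\equiv 1\pmod 3$, then $\ell_7(3^r)=3$.
   Context: For a prime $p\ge 5$ and a positive integer $\delta$ with $p\nmid\delta$, $\ell_p(\delta)$ is the smallest positive integer $x$ such that the Legendre symbol $\big(\frac{ -3\delta^2x^2-12}{p}\big)\in\{0,1\}$. -}

module Defs where

open import Data.Nat using (ℕ; suc; _<_; _≤_; _^_)
open import Data.Integer as ℤ using (ℤ; +_; -_)
open import Data.Integer.Divisibility using (_∣_)
open import Data.Product using (∃; _×_)
open import Relation.Nullary using (¬_)

-- Legendre symbol (a / p) ∈ {0, 1}  ⟺  a is congruent to a square mod p
-- (value 0: p ∣ a, which is 0²; value 1: a nonzero quadratic residue).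
LegendreIn01 : ℕ → ℤ → Set
LegendreIn01 p a = ∃ λ (y : ℤ) → (+ p) ∣ (y ℤ.* y ℤ.- a)

quantity : ℕ → ℕ → ℤ
quantity δ x = - (+ 3 ℤ.* (+ δ) ℤ.* (+ δ) ℤ.* (+ x) ℤ.* (+ x)) ℤ.- + 12

Good : ℕ → ℕ → ℕ → Set
Good p δ x = LegendreIn01 p (quantity δ x)

-- x = ℓ_p(δ): the smallest positive integer x with Good p δ x
IsEll : ℕ → ℕ → ℕ → Set
IsEll p δ x = 1 ≤ x × Good p δ x × (∀ y → 1 ≤ y → y < x → ¬ Good p δ y)

{-# OPTIONS --safe #-}
-- Good p δ x depends on δ only through δ² mod p, and 3² = 9 has order 3 modulo 7, so
-- ℓ₇(3^r) = ℓ₇(3^(r mod 3)).  The three values ℓ₇(1) = 2, ℓ₇(3) = 3 and ℓ₇(9) = 1 are then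
-- computed, quadratic residuosity modulo p being decidable by trying the residues 0, …, p - 1.
module Submission where

open import Defs
open import Data.Nat using (ℕ; _≤_; _^_; _%_)
open import Data.Product using (∃; _×_; _,_)
open import Data.Sum using (_⊎_; inj₁; inj₂)
open import Relation.Binary.PropositionalEquality
  using (_≡_; refl; sym; trans; cong; cong₂; subst; module ≡-Reasoning)

open import Data.Nat as ℕ using (suc; s≤s; z≤n; NonZero)
import Data.Nat.Properties as ℕ
open import Data.Nat.Solver using (module +-*-Solver)
open import Data.Integer as ℤ using (+_; -_)
import Data.Integer.Properties as ℤ
import Data.Integer.DivMod as ℤ
open import Data.Integer.Divisibility.Signed
  using (divides; ∣ᵤ⇒∣; ∣⇒∣ᵤ; ∣m∣n⇒∣m+n; ∣m∣n⇒∣m-n; ∣m⇒∣-m) renaming (_∣_ to _∣ₛ_; _∣?_ to _∣?ₛ_)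
open import Data.Integer.Solver using (module +-*-Solver)
open import Data.Fin using (Fin; toℕ; fromℕ<)
open import Data.Fin.Properties using (any?; toℕ-fromℕ<)
open import Function using (_∘_)
open import Function.Bundles using (_⇔_; mk⇔; Equivalence)
open import Relation.Nullary using (Dec)
open import Relation.Nullary.Decidable using (map′; from-yes; from-no)

module ℤSolver = Data.Integer.Solver.+-*-Solver
module ℕSolver = Data.Nat.Solver.+-*-Solver

legendreIn01-resp : ∀ {p a b} → + p ∣ₛ a ℤ.- b → LegendreIn01 p a → LegendreIn01 p b
legendreIn01-resp {p} {a} {b} p∣a-b (y , p∣y²-a) =
  y , ∣⇒∣ᵤ (subst (+ p ∣ₛ_) split (∣m∣n⇒∣m+n (∣ᵤ⇒∣ {i = y ℤ.* y ℤ.- a} p∣y²-a) p∣a-b))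
  where
  open ℤSolver
  split : (y ℤ.* y ℤ.- a) ℤ.+ (a ℤ.- b) ≡ y ℤ.* y ℤ.- b
  split = solve 3 (λ y a b → (y :* y :- a) :+ (a :- b) := y :* y :- b) refl y a b

legendreIn01-cong : ∀ {p a b} → + p ∣ₛ a ℤ.- b → LegendreIn01 p a ⇔ LegendreIn01 p b
legendreIn01-cong {p} {a} {b} p∣a-b =
  mk⇔ (legendreIn01-resp p∣a-b) (legendreIn01-resp (subst (+ p ∣ₛ_) flip (∣m⇒∣-m p∣a-b)))
  where
  open ℤSolver
  flip : - (a ℤ.- b) ≡ b ℤ.- a
  flip = solve 2 (λ a b → :- (a :- b) := b :- a) refl a b

legendreIn01⇔residue : ∀ p .{{_ : NonZero p}} a →
  LegendreIn01 p a ⇔ ∃ λ (t : Fin p) → + p ∣ₛ + toℕ t ℤ.* + toℕ t ℤ.- a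
legendreIn01⇔residue p a = mk⇔ reduce (λ (t , p∣t²-a) → + toℕ t , ∣⇒∣ᵤ p∣t²-a)
  where
  reduce : LegendreIn01 p a → ∃ λ (t : Fin p) → + p ∣ₛ + toℕ t ℤ.* + toℕ t ℤ.- a
  reduce (y , p∣y²-a) = t , (subst (+ p ∣ₛ_) shift
      (∣m∣n⇒∣m-n (∣ᵤ⇒∣ {i = y ℤ.* y ℤ.- a} p∣y²-a) (divides (k ℤ.* (+ 2 ℤ.* + r ℤ.+ k ℤ.* + p)) refl)))
    where
    open ≡-Reasoning
    open ℤSolver
    r = y ℤ.% + p
    k = y ℤ./ + p
    t = fromℕ< (ℤ.n%d<d y (+ p))
    shift : (y ℤ.* y ℤ.- a) ℤ.- k ℤ.* (+ 2 ℤ.* + r ℤ.+ k ℤ.* + p) ℤ.* + p ≡ + toℕ t ℤ.* + toℕ t ℤ.- a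
    shift = begin
      (y ℤ.* y ℤ.- a) ℤ.- k ℤ.* (+ 2 ℤ.* + r ℤ.+ k ℤ.* + p) ℤ.* + p
        ≡⟨ cong (λ z → (z ℤ.* z ℤ.- a) ℤ.- k ℤ.* (+ 2 ℤ.* + r ℤ.+ k ℤ.* + p) ℤ.* + p)
                (ℤ.a≡a%n+[a/n]*n y (+ p)) ⟩
      ((+ r ℤ.+ k ℤ.* + p) ℤ.* (+ r ℤ.+ k ℤ.* + p) ℤ.- a) ℤ.- k ℤ.* (+ 2 ℤ.* + r ℤ.+ k ℤ.* + p) ℤ.* + p
        ≡⟨ solve 4 (λ r k p a → ((r :+ k :* p) :* (r :+ k :* p) :- a) :- k :* (con (+ 2) :* r :+ k :* p) :* p
                              := r :* r :- a) refl (+ r) k (+ p) a ⟩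
      + r ℤ.* + r ℤ.- a
        ≡⟨ cong (λ n → + n ℤ.* + n ℤ.- a) (sym (toℕ-fromℕ< (ℤ.n%d<d y (+ p)))) ⟩
      + toℕ t ℤ.* + toℕ t ℤ.- a ∎

legendreIn01? : ∀ p .{{_ : NonZero p}} a → Dec (LegendreIn01 p a)
legendreIn01? p a =
  map′ from to (any? λ t → + p ∣?ₛ (+ toℕ t ℤ.* + toℕ t ℤ.- a))
  where open Equivalence (legendreIn01⇔residue p a)

good? : ∀ p .{{_ : NonZero p}} δ x → Dec (Good p δ x)
good? p δ x = legendreIn01? p (quantity δ x)

quantity-via-δ² : ∀ δ x → quantity δ x ≡ - (+ 3 ℤ.* + (δ ℕ.* δ) ℤ.* (+ x ℤ.* + x)) ℤ.- + 12
quantity-via-δ² δ x = begin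
  quantity δ x
    ≡⟨ solve 2 (λ δ x → :- (con (+ 3) :* δ :* δ :* x :* x) :- con (+ 12)
                       := :- (con (+ 3) :* (δ :* δ) :* (x :* x)) :- con (+ 12)) refl (+ δ) (+ x) ⟩
  - (+ 3 ℤ.* (+ δ ℤ.* + δ) ℤ.* (+ x ℤ.* + x)) ℤ.- + 12
    ≡⟨ cong (λ s → - (+ 3 ℤ.* s ℤ.* (+ x ℤ.* + x)) ℤ.- + 12) (sym (ℤ.pos-* δ δ)) ⟩
  - (+ 3 ℤ.* + (δ ℕ.* δ) ℤ.* (+ x ℤ.* + x)) ℤ.- + 12 ∎
  where
  open ≡-Reasoning
  open ℤSolver

quantity-cong : ∀ {p} δ δ′ x → (∃ λ M → δ ℕ.* δ ≡ p ℕ.* M ℕ.+ δ′ ℕ.* δ′) →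
  + p ∣ₛ quantity δ x ℤ.- quantity δ′ x
quantity-cong {p} δ δ′ x (M , δ²≡) = divides (- (+ 3 ℤ.* + M ℤ.* (+ x ℤ.* + x))) (begin
  quantity δ x ℤ.- quantity δ′ x
    ≡⟨ cong₂ ℤ._-_ (quantity-via-δ² δ x) (quantity-via-δ² δ′ x) ⟩
  (- (+ 3 ℤ.* + (δ ℕ.* δ) ℤ.* x²) ℤ.- + 12) ℤ.- (- (+ 3 ℤ.* + (δ′ ℕ.* δ′) ℤ.* x²) ℤ.- + 12)
    ≡⟨ cong (λ s → (- (+ 3 ℤ.* s ℤ.* x²) ℤ.- + 12) ℤ.- (- (+ 3 ℤ.* + (δ′ ℕ.* δ′) ℤ.* x²) ℤ.- + 12)) δ²≡ℤ ⟩
  (- (+ 3 ℤ.* (+ p ℤ.* + M ℤ.+ + (δ′ ℕ.* δ′)) ℤ.* x²) ℤ.- + 12) ℤ.- (- (+ 3 ℤ.* + (δ′ ℕ.* δ′) ℤ.* x²) ℤ.- + 12)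
    ≡⟨ solve 4 (λ p M s x² → (:- (con (+ 3) :* (p :* M :+ s) :* x²) :- con (+ 12)) :- (:- (con (+ 3) :* s :* x²) :- con (+ 12))
                           := :- (con (+ 3) :* M :* x²) :* p) refl (+ p) (+ M) (+ (δ′ ℕ.* δ′)) x² ⟩
  - (+ 3 ℤ.* + M ℤ.* x²) ℤ.* + p ∎)
  where
  open ≡-Reasoning
  open ℤSolver
  x² = + x ℤ.* + x
  δ²≡ℤ : + (δ ℕ.* δ) ≡ + p ℤ.* + M ℤ.+ + (δ′ ℕ.* δ′)
  δ²≡ℤ = trans (cong +_ δ²≡) (trans (ℤ.pos-+ (p ℕ.* M) _) (cong (ℤ._+ + (δ′ ℕ.* δ′)) (ℤ.pos-* p M)))

isEll-cong : ∀ {p x} δ δ′ → (∃ λ M → δ ℕ.* δ ≡ p ℕ.* M ℕ.+ δ′ ℕ.* δ′) → IsEll p δ′ x → IsEll p δ x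
isEll-cong {p} δ δ′ δ²≡ (1≤x , good , minimal) =
  1≤x , from (good-cong _) good , λ y 1≤y y<x → minimal y 1≤y y<x ∘ to (good-cong y)
  where
  open Equivalence
  good-cong : ∀ y → Good p δ y ⇔ Good p δ′ y
  good-cong y = legendreIn01-cong (quantity-cong δ δ′ y δ²≡)

-- 3⁶ = 729 = 7 · 104 + 1
pow3-sq-mod7 : ∀ r → ∃ λ M → 3 ^ r ℕ.* 3 ^ r ≡ 7 ℕ.* M ℕ.+ 3 ^ (r % 3) ℕ.* 3 ^ (r % 3)
pow3-sq-mod7 0 = 0 , refl
pow3-sq-mod7 1 = 0 , refl
pow3-sq-mod7 2 = 0 , refl
pow3-sq-mod7 (suc (suc (suc r))) with pow3-sq-mod7 r
... | M , eq = 729 ℕ.* M ℕ.+ 104 ℕ.* s , (begin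
  (3 ℕ.* (3 ℕ.* (3 ℕ.* a))) ℕ.* (3 ℕ.* (3 ℕ.* (3 ℕ.* a)))
    ≡⟨ solve 1 (λ a → (con 3 :* (con 3 :* (con 3 :* a))) :* (con 3 :* (con 3 :* (con 3 :* a))) := con 729 :* (a :* a)) refl a ⟩
  729 ℕ.* (a ℕ.* a)
    ≡⟨ cong (729 ℕ.*_) eq ⟩
  729 ℕ.* (7 ℕ.* M ℕ.+ s)
    ≡⟨ solve 2 (λ M s → con 729 :* (con 7 :* M :+ s) := con 7 :* (con 729 :* M :+ con 104 :* s) :+ s) refl M s ⟩
  7 ℕ.* (729 ℕ.* M ℕ.+ 104 ℕ.* s) ℕ.+ s ∎)
  where
  open ≡-Reasoning
  open ℕSolver
  a = 3 ^ r
  s = 3 ^ (r % 3) ℕ.* 3 ^ (r % 3)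

ℓ₇1≡2 : IsEll 7 1 2
ℓ₇1≡2 = s≤s z≤n , from-yes (good? 7 1 2) , λ where
  1 _ _ → from-no (good? 7 1 1)
  (suc (suc _)) _ (s≤s (s≤s ()))

ℓ₇3≡3 : IsEll 7 3 3
ℓ₇3≡3 = s≤s z≤n , from-yes (good? 7 3 3) , λ where
  1 _ _ → from-no (good? 7 3 1)
  2 _ _ → from-no (good? 7 3 2)
  (suc (suc (suc _))) _ (s≤s (s≤s (s≤s ())))

ℓ₇9≡1 : IsEll 7 9 1
ℓ₇9≡1 = s≤s z≤n , from-yes (good? 7 9 1) , λ where
  (suc _) _ (s≤s ())

lemma5p1 : (r : ℕ) →
    (((r % 3 ≡ 0 ⊎ r % 3 ≡ 2) → ∃ λ x → IsEll 7 (3 ^ r) x × x ≤ 2)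
    × (r % 3 ≡ 1 → IsEll 7 (3 ^ r) 3))
lemma5p1 r = ℓ≤2 , ℓ≡3
  where
  reduce : ∀ {j x} → r % 3 ≡ j → IsEll 7 (3 ^ j) x → IsEll 7 (3 ^ r) x
  reduce refl = isEll-cong (3 ^ r) (3 ^ (r % 3)) (pow3-sq-mod7 r)

  ℓ≤2 : (r % 3 ≡ 0 ⊎ r % 3 ≡ 2) → ∃ λ x → IsEll 7 (3 ^ r) x × x ≤ 2
  ℓ≤2 (inj₁ r≡0) = 2 , reduce r≡0 ℓ₇1≡2 , ℕ.≤-refl
  ℓ≤2 (inj₂ r≡2) = 1 , reduce r≡2 ℓ₇9≡1 , s≤s z≤n

  ℓ≡3 : r % 3 ≡ 1 → IsEll 7 (3 ^ r) 3
  ℓ≡3 r≡1 = reduce r≡1 ℓ₇3≡3
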